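{- Let $n\ge 6$ and let $\mathcal F\subset\binom{[n]}{3}$ be an almost intersecting family with $\{1,2,3\},\{4,5,6\}\in\mathcal F$. For $1\le a\le 3$, $4\le b\le 6$ let $D(a,b)=\{c\in[7,n]:\{a,b,c\}\in\mathcal F\}$. If $|D(a,b)|\ge 3$ for some $1\le a\le 3$, $4\le b\le 6$, then $\{a,b\}\cap F\neq\emptyset$ for all $F\in\mathcal F$.
   Context: $[7,n]=\{7,\dots,n\}$. A family $\mathcal F$ is almost intersecting if it is not intersecting (some two members are disjoint) but each $F\in\mathcal F$ is disjoint from at most one member of $\mathcal F$. -}

module Defs where

open import Data.Nat using (ℕ; _≤?_)
open import Data.Bool using (Bool; true; _∧_)
open import Data.Fin using (Fin; toℕ)
open import Data.Fin.Subset using (Subset; ⁅_⁆; _∩_; _∪_; Empty; ∣_∣)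
open import Data.Vec using (tabulate)
open import Data.Product using (∃₂; _×_)
open import Relation.Nullary.Decidable using (⌊_⌋)
open import Relation.Binary.PropositionalEquality using (_≡_)

-- Ground set [n] = {1,…,n} is modelled by Fin n; i : Fin n stands for toℕ i + 1.
-- A family 𝓕 of subsets of [n] is a Boolean predicate on Subset n; F ∈ 𝓕 iff 𝓕 F ≡ true.
Family : ℕ → Set
Family n = Subset n → Bool

_∈F_ : ∀ {n} → Subset n → Family n → Set
F ∈F 𝓕 = 𝓕 F ≡ true

Disjoint : ∀ {n} → Subset n → Subset n → Set
Disjoint F G = Empty (F ∩ G)

Uniform3 : ∀ {n} → Family n → Set
Uniform3 𝓕 = ∀ F → F ∈F 𝓕 → ∣ F ∣ ≡ 3

AlmostIntersecting : ∀ {n} → Family n → Set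
AlmostIntersecting 𝓕 =
  (∃₂ λ F G → F ∈F 𝓕 × G ∈F 𝓕 × Disjoint F G) ×
  (∀ F G H → F ∈F 𝓕 → G ∈F 𝓕 → H ∈F 𝓕 → Disjoint F G → Disjoint F H → G ≡ H)

triple : ∀ {n} → Fin n → Fin n → Fin n → Subset n
triple x y z = ⁅ x ⁆ ∪ ⁅ y ⁆ ∪ ⁅ z ⁆

-- D(a,b) = { c ∈ [7,n] : {a,b,c} ∈ 𝓕 }   (c ∈ [7,n] iff toℕ c + 1 ≥ 7 iff 6 ≤ toℕ c)
D : ∀ {n} → Family n → Fin n → Fin n → Subset n
D 𝓕 a b = tabulate (λ c → ⌊ 6 ≤? toℕ c ⌋ ∧ 𝓕 (triple a b c))

-- A member F avoiding {a, b} lies in a family of five sets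
-- {1,2,3}, {4,5,6}, {a,b,c₁}, {a,b,c₂}, {a,b,c₃} (cᵢ ∈ D(a,b)) whose pairwise
-- intersections lie inside {a, b}.  Being almost intersecting, F is disjoint
-- from at most one of them, so it meets four of them in four distinct points,
-- contradicting |F| = 3.
module Submission where

open import Defs
open import Data.Nat using (ℕ; zero; suc; _+_; _≤_; _<_; z≤n; s≤s)
open import Data.Nat.Properties using (≤-trans; ≤-reflexive; +-suc; +-monoʳ-≤; n≤1+n; n≮n)
open import Data.Fin using (Fin; zero; suc; toℕ; punchIn)
open import Data.Fin.Properties
  using (_≟_; any?; 0≢1+n; suc-injective; toℕ-injective; punchIn-injective; punchInᵢ≢i)
open import Data.Fin.Subset
  using (Subset; inside; outside; ⁅_⁆; _∪_; _∩_; _∈_; _∉_; _⊈_; _-_; Nonempty; ∣_∣)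
open import Data.Fin.Subset.Properties
open import Data.Bool.Properties using (T-≡; T-∧)
open import Data.Vec using (_∷_; []; here; there)
open import Data.Vec.Properties using ([]=⇒lookup; lookup∘tabulate)
open import Data.Product using (Σ; ∃; _×_; _,_; proj₁; proj₂) renaming (map to ×-map)
open import Data.Sum using (_⊎_; inj₁; inj₂)
open import Data.Empty using (⊥-elim)
open import Function using (_∘_; Injective; Equivalence)
open import Relation.Nullary using (yes; no; ¬?)
open import Relation.Nullary.Decidable using (toWitness; decidable-stable)
open import Relation.Binary.PropositionalEquality using (_≡_; _≢_; refl; sym; trans; cong; cong₂; subst)

private
  variable
    n : ℕ

∣p∪q∣≤∣p∣+∣q∣ : (p q : Subset n) → ∣ p ∪ q ∣ ≤ ∣ p ∣ + ∣ q ∣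
∣p∪q∣≤∣p∣+∣q∣ []            []            = z≤n
∣p∪q∣≤∣p∣+∣q∣ (outside ∷ p) (outside ∷ q) = ∣p∪q∣≤∣p∣+∣q∣ p q
∣p∪q∣≤∣p∣+∣q∣ (outside ∷ p) (inside  ∷ q) =
  ≤-trans (s≤s (∣p∪q∣≤∣p∣+∣q∣ p q)) (≤-reflexive (sym (+-suc ∣ p ∣ ∣ q ∣)))
∣p∪q∣≤∣p∣+∣q∣ (inside  ∷ p) (outside ∷ q) = s≤s (∣p∪q∣≤∣p∣+∣q∣ p q)
∣p∪q∣≤∣p∣+∣q∣ (inside  ∷ p) (inside  ∷ q) =
  s≤s (≤-trans (∣p∪q∣≤∣p∣+∣q∣ p q) (+-monoʳ-≤ ∣ p ∣ (n≤1+n ∣ q ∣)))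

∣⁅x⁆∪⁅y⁆∣≤2 : (x y : Fin n) → ∣ ⁅ x ⁆ ∪ ⁅ y ⁆ ∣ ≤ 2
∣⁅x⁆∪⁅y⁆∣≤2 x y =
  ≤-trans (∣p∪q∣≤∣p∣+∣q∣ ⁅ x ⁆ ⁅ y ⁆) (≤-reflexive (cong₂ _+_ (∣⁅x⁆∣≡1 x) (∣⁅x⁆∣≡1 y)))

x∈triple⁻ : ∀ {x y z e : Fin n} → e ∈ triple x y z → e ≡ x ⊎ e ≡ y ⊎ e ≡ z
x∈triple⁻ {x = x} {y} {z} e∈xyz with x∈p∪q⁻ ⁅ x ⁆ (⁅ y ⁆ ∪ ⁅ z ⁆) e∈xyz
... | inj₁ e∈x  = inj₁ (x∈⁅y⁆⇒x≡y x e∈x)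
... | inj₂ e∈yz with x∈p∪q⁻ ⁅ y ⁆ ⁅ z ⁆ e∈yz
...   | inj₁ e∈y = inj₂ (inj₁ (x∈⁅y⁆⇒x≡y y e∈y))
...   | inj₂ e∈z = inj₂ (inj₂ (x∈⁅y⁆⇒x≡y z e∈z))

injection⇒≤∣p∣ : ∀ {k} {p : Subset n} (f : Fin k → Fin n) →
                 Injective _≡_ _≡_ f → (∀ i → f i ∈ p) → k ≤ ∣ p ∣
injection⇒≤∣p∣ {k = zero}  _ _ _ = z≤n
injection⇒≤∣p∣ {k = suc k} f f-inj f∈p =
  ≤-trans (s≤s (injection⇒≤∣p∣ (f ∘ suc) (suc-injective ∘ f-inj) f∘suc∈p-f₀))
          (x∈p⇒∣p-x∣<∣p∣ (f∈p zero))
  where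
  f∘suc∈p-f₀ : ∀ i → f (suc i) ∈ _ - f zero
  f∘suc∈p-f₀ i = x∈p∧x≢y⇒x∈p-y (f∈p (suc i)) (λ eq → 0≢1+n (sym (f-inj eq)))

≤∣p∣⇒injection : ∀ {k} (p : Subset n) → k ≤ ∣ p ∣ →
                 Σ (Fin k → Fin n) λ f → Injective _≡_ _≡_ f × (∀ i → f i ∈ p)
≤∣p∣⇒injection {k = zero}  p             _ = (λ ()) , (λ { {()} }) , (λ ())
≤∣p∣⇒injection {k = suc k} (outside ∷ p) k<∣p∣ with ≤∣p∣⇒injection p k<∣p∣
... | f , f-inj , f∈p = suc ∘ f , f-inj ∘ suc-injective , there ∘ f∈p
≤∣p∣⇒injection {k = suc k} (inside ∷ p) (s≤s k≤∣p∣) with ≤∣p∣⇒injection p k≤∣p∣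
... | f , f-inj , f∈p = g , g-inj , g∈p
  where
  g : Fin (suc k) → Fin (suc _)
  g zero    = zero
  g (suc i) = suc (f i)
  g-inj : Injective _≡_ _≡_ g
  g-inj {zero}  {zero}  _  = refl
  g-inj {suc i} {suc j} eq = cong suc (f-inj (suc-injective eq))
  g∈p : ∀ i → g i ∈ inside ∷ p
  g∈p zero    = here
  g∈p (suc i) = there (f∈p i)

DisjointOutside : ∀ {m} → Subset n → (Fin m → Subset n) → Set
DisjointOutside K S = ∀ {i j e} → e ∈ S i → e ∈ S j → e ∉ K → i ≡ j

module _ {m} {𝓕 : Family n} (𝓕-ai : AlmostIntersecting 𝓕)
         {K : Subset n} {S : Fin (suc m) → Subset n}
         (S∈𝓕 : ∀ i → S i ∈F 𝓕) (S-disjoint : DisjointOutside K S) (S⊈K : ∀ i → S i ⊈ K)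
         {F : Subset n} (F∈𝓕 : F ∈F 𝓕) (F-avoids-K : ∀ {e} → e ∈ F → e ∉ K) where

  private
    S-injective : Injective _≡_ _≡_ S
    S-injective {i} {j} Si≡Sj with i ≟ j
    ... | yes i≡j = i≡j
    ... | no  i≢j = ⊥-elim (S⊈K i λ {e} e∈Si →
      decidable-stable (e ∈? K) λ e∉K → i≢j (S-disjoint e∈Si (subst (e ∈_) Si≡Sj e∈Si) e∉K))

    meets-all-but-one : ∃ λ j → ∀ i → i ≢ j → Nonempty (F ∩ S i)
    meets-all-but-one with any? (λ j → ¬? (nonempty? (F ∩ S j)))
    ... | yes (j , F∩Sj≡∅) = j , λ i i≢j → decidable-stable (nonempty? _) λ F∩Si≡∅ →
      i≢j (S-injective (proj₂ 𝓕-ai F (S i) (S j) F∈𝓕 (S∈𝓕 i) (S∈𝓕 j) F∩Si≡∅ F∩Sj≡∅))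
    ... | no ∄j = zero , λ i _ → decidable-stable (nonempty? _) λ F∩Si≡∅ → ∄j (i , F∩Si≡∅)

  almostIntersecting⇒≤∣F∣ : m ≤ ∣ F ∣
  almostIntersecting⇒≤∣F∣ = injection⇒≤∣p∣ point point-injective (proj₁ ∘ point∈F∩S)
    where
    j : Fin (suc m)
    j = proj₁ meets-all-but-one
    point : Fin m → Fin n
    point i = proj₁ (proj₂ meets-all-but-one (punchIn j i) (punchInᵢ≢i j i))
    point∈F∩S : ∀ i → point i ∈ F × point i ∈ S (punchIn j i)
    point∈F∩S i = x∈p∩q⁻ F _ (proj₂ (proj₂ meets-all-but-one (punchIn j i) (punchInᵢ≢i j i)))
    point-injective : Injective _≡_ _≡_ point
    point-injective {i} {i′} eq = punchIn-injective j i i′ (S-disjoint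
      (proj₂ (point∈F∩S i)) (subst (_∈ S _) (sym eq) (proj₂ (point∈F∩S i′)))
      (F-avoids-K (proj₁ (point∈F∩S i))))

-- With i : Fin n standing for toℕ i + 1, block 0 is {1,2,3}, block 1 is {4,5,6},
-- and every element of [7,n] is a block of its own.
block : ℕ → ℕ
block 0 = 0
block 1 = 0
block 2 = 0
block 3 = 1
block 4 = 1
block 5 = 1
block (suc (suc (suc (suc (suc (suc k)))))) = 6 + k

block-≥6 : ∀ {k} → 6 ≤ k → block k ≡ k
block-≥6 (s≤s (s≤s (s≤s (s≤s (s≤s (s≤s _)))))) = refl

triple-block : ∀ {x y z e : Fin n} {β} →
               block (toℕ x) ≡ β → block (toℕ y) ≡ β → block (toℕ z) ≡ β →
               e ∈ triple x y z → block (toℕ e) ≡ β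
triple-block βx βy βz e∈xyz with x∈triple⁻ e∈xyz
... | inj₁ refl        = βx
... | inj₂ (inj₁ refl) = βy
... | inj₂ (inj₂ refl) = βz

∈D⁻ : ∀ (𝓕 : Family n) a b {c} → c ∈ D 𝓕 a b → 6 ≤ toℕ c × triple a b c ∈F 𝓕
∈D⁻ _ _ _ {c} c∈D = ×-map toWitness (Equivalence.to T-≡) (Equivalence.to T-∧
  (Equivalence.from T-≡ (trans (sym (lookup∘tabulate _ c)) ([]=⇒lookup c∈D))))

module FiveSets {𝓕 : Family n} (𝓕-3 : Uniform3 𝓕) {T₁ T₂ : Subset n} {a b : Fin n}
                (T₁∈𝓕 : T₁ ∈F 𝓕) (T₂∈𝓕 : T₂ ∈F 𝓕)
                (T₁-block : ∀ {e} → e ∈ T₁ → block (toℕ e) ≡ 0)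
                (T₂-block : ∀ {e} → e ∈ T₂ → block (toℕ e) ≡ 1)
                {c : Fin 3 → Fin n} (c-injective : Injective _≡_ _≡_ c)
                (c∈D : ∀ k → c k ∈ D 𝓕 a b) where

  K : Subset n
  K = ⁅ a ⁆ ∪ ⁅ b ⁆

  S : Fin 5 → Subset n
  S zero          = T₁
  S (suc zero)    = T₂
  S (suc (suc k)) = triple a b (c k)

  S∈𝓕 : ∀ i → S i ∈F 𝓕
  S∈𝓕 zero          = T₁∈𝓕
  S∈𝓕 (suc zero)    = T₂∈𝓕
  S∈𝓕 (suc (suc k)) = proj₂ (∈D⁻ 𝓕 a b (c∈D k))

  S⊈K : ∀ i → S i ⊈ K
  S⊈K i S⊆K = n≮n 2 (subst (_≤ 2) (𝓕-3 (S i) (S∈𝓕 i))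
                               (≤-trans (p⊆q⇒∣p∣≤∣q∣ S⊆K) (∣⁅x⁆∪⁅y⁆∣≤2 a b)))

  private
    label : Fin 5 → ℕ
    label zero          = 0
    label (suc zero)    = 1
    label (suc (suc k)) = toℕ (c k)

    6≤c : ∀ k → 6 ≤ toℕ (c k)
    6≤c k = proj₁ (∈D⁻ 𝓕 a b (c∈D k))

    label-injective : Injective _≡_ _≡_ label
    label-injective {zero}        {zero}         _  = refl
    label-injective {suc zero}    {suc zero}     _  = refl
    label-injective {zero}        {suc (suc k)}  eq with () ← subst (6 ≤_) (sym eq) (6≤c k)
    label-injective {suc zero}    {suc (suc k)}  eq with s≤s () ← subst (6 ≤_) (sym eq) (6≤c k)
    label-injective {suc (suc k)} {zero}         eq with () ← subst (6 ≤_) eq (6≤c k)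
    label-injective {suc (suc k)} {suc zero}     eq with s≤s () ← subst (6 ≤_) eq (6≤c k)
    label-injective {suc (suc k)} {suc (suc k′)} eq
      rewrite c-injective (toℕ-injective eq) = refl

    block-outside-K : ∀ i {e} → e ∈ S i → e ∉ K → block (toℕ e) ≡ label i
    block-outside-K zero          e∈S _   = T₁-block e∈S
    block-outside-K (suc zero)    e∈S _   = T₂-block e∈S
    block-outside-K (suc (suc k)) e∈S e∉K with x∈triple⁻ e∈S
    ... | inj₁ refl        = ⊥-elim (e∉K (x∈p∪q⁺ (inj₁ (x∈⁅x⁆ a))))
    ... | inj₂ (inj₁ refl) = ⊥-elim (e∉K (x∈p∪q⁺ (inj₂ (x∈⁅x⁆ b))))
    ... | inj₂ (inj₂ refl) = block-≥6 (6≤c k)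

  S-disjoint : DisjointOutside K S
  S-disjoint {i} {j} e∈Si e∈Sj e∉K =
    label-injective (trans (sym (block-outside-K i e∈Si e∉K)) (block-outside-K j e∈Sj e∉K))

lemma4p2 : (n : ℕ) → 6 ≤ n → (𝓕 : Family n) → Uniform3 𝓕 → AlmostIntersecting 𝓕 →
           (i1 i2 i3 i4 i5 i6 : Fin n) →
           toℕ i1 ≡ 0 → toℕ i2 ≡ 1 → toℕ i3 ≡ 2 → toℕ i4 ≡ 3 → toℕ i5 ≡ 4 → toℕ i6 ≡ 5 →
           triple i1 i2 i3 ∈F 𝓕 → triple i4 i5 i6 ∈F 𝓕 →
           (a b : Fin n) → toℕ a < 3 → 3 ≤ toℕ b → toℕ b < 6 →
           3 ≤ ∣ D 𝓕 a b ∣ →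
           (F : Subset n) → F ∈F 𝓕 → Nonempty ((⁅ a ⁆ ∪ ⁅ b ⁆) ∩ F)
lemma4p2 n _ 𝓕 𝓕-3 𝓕-ai i1 i2 i3 i4 i5 i6 i1≡0 i2≡1 i3≡2 i4≡3 i5≡4 i6≡5 T₁∈𝓕 T₂∈𝓕
         a b _ _ _ 3≤∣D∣ F F∈𝓕 with nonempty? ((⁅ a ⁆ ∪ ⁅ b ⁆) ∩ F)
... | yes F-meets-K = F-meets-K
... | no  F-misses-K = ⊥-elim (n≮n 3 (subst (4 ≤_) (𝓕-3 F F∈𝓕) 4≤∣F∣))
  where
  c : Σ (Fin 3 → Fin n) λ f → Injective _≡_ _≡_ f × (∀ k → f k ∈ D 𝓕 a b)
  c = ≤∣p∣⇒injection (D 𝓕 a b) 3≤∣D∣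
  open FiveSets 𝓕-3 T₁∈𝓕 T₂∈𝓕
    (triple-block (cong block i1≡0) (cong block i2≡1) (cong block i3≡2))
    (triple-block (cong block i4≡3) (cong block i5≡4) (cong block i6≡5))
    (proj₁ (proj₂ c)) (proj₂ (proj₂ c))
  4≤∣F∣ : 4 ≤ ∣ F ∣
  4≤∣F∣ = almostIntersecting⇒≤∣F∣ 𝓕-ai S∈𝓕 S-disjoint S⊈K F∈𝓕
            (λ e∈F e∈K → F-misses-K (_ , x∈p∩q⁺ (e∈K , e∈F)))
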